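{- Let $\varphi=(1+\sqrt5)/2$ and let $f:\mathbb{N}\to\mathbb{N}$ be the sequence defined by $f(0)=0$ and, for $n\ge 1$, $f(n)$ is the least natural number such that $f(n)\notin\{f(0),f(1),\ldots,f(n-1)\}$ and $\sum_{1\le i\le n} f(i)$ is divisible by $n$. Then $\lfloor n/\varphi\rfloor+1\le f(n)\le\lfloor n\varphi\rfloor$ for all $n\ge 1$.
   Context: $\mathbb{N}=\{0,1,2,\ldots\}$. -}

module Defs where

open import Data.Nat using (ℕ; zero; suc; _+_; _*_; _∸_; _≤_; _<_)
open import Data.Nat.Divisibility using (_∣_)
open import Data.Product using (_×_; Σ)
open import Data.Sum using (_⊎_)
open import Relation.Binary.PropositionalEquality using (_≡_)
open import Relation.Nullary using (¬_)

-- φ = (1 + √5)/2,  1/φ = φ - 1 = (√5 - 1)/2.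
-- All comparisons below are between a natural number x and the real
-- numbers n·φ = (n + n√5)/2 and n/φ = (n√5 - n)/2, rewritten exactly
-- in ℕ-arithmetic (both sides non-negative, so squaring is monotone).

sq : ℕ → ℕ
sq a = a * a

-- x ≤ n·φ   ⇔  2x - n ≤ n√5  ⇔  (2x ∸ n)² ≤ 5n²
_≤nφ_ : ℕ → ℕ → Set
x ≤nφ n = sq (2 * x ∸ n) ≤ 5 * sq n

-- n·φ < x   ⇔  n√5 < 2x - n  ⇔  5n² < (2x ∸ n)²
_nφ<_ : ℕ → ℕ → Set
n nφ< x = 5 * sq n < sq (2 * x ∸ n)

-- x ≤ n/φ   ⇔  2x + n ≤ n√5  ⇔  (2x + n)² ≤ 5n²
_≤n/φ_ : ℕ → ℕ → Set
x ≤n/φ n = sq (2 * x + n) ≤ 5 * sq n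

-- n/φ < x   ⇔  n√5 < 2x + n  ⇔  5n² < (2x + n)²
_n/φ<_ : ℕ → ℕ → Set
n n/φ< x = 5 * sq n < sq (2 * x + n)

IsFloorMulφ : ℕ → ℕ → Set
IsFloorMulφ n m = (m ≤nφ n) × (n nφ< suc m)

IsFloorDivφ : ℕ → ℕ → Set
IsFloorDivφ n m = (m ≤n/φ n) × (n n/φ< suc m)

sumFrom1 : (ℕ → ℕ) → ℕ → ℕ
sumFrom1 f zero    = 0
sumFrom1 f (suc n) = sumFrom1 f n + f (suc n)

Among : (ℕ → ℕ) → ℕ → ℕ → Set
Among f n v = Σ ℕ (λ i → i < n × f i ≡ v)

Admissible : (ℕ → ℕ) → ℕ → ℕ → Set
Admissible f n v = ¬ Among f n v × (n ∣ sumFrom1 f (n ∸ 1) + v)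

IsSeq : (ℕ → ℕ) → Set
IsSeq f = (f 0 ≡ 0)
        × ((n : ℕ) → 1 ≤ n →
             Admissible f n (f n) × ((m : ℕ) → m < f n → ¬ Admissible f n m))

-- Write α = 1/φ, so that α² + α = 1, and a(n) = ⌊nα⌋.  The sequence turns out to be
-- g(n) = ⌊nφ⌋ = n + a(n) if a jumps at n (a(n) = a(n−1) + 1) and g(n) = a(n) + 1 otherwise,
-- whence a(n) + 1 ≤ g(n) ≤ n + a(n) ≤ ⌊nφ⌋.  The partial sums of g are n(a(n) + 1), so
-- inductively the divisibility condition forces f(n+1) ≡ a(n) + 1 (mod n + 1).  The value
-- a(n) + 1 is new exactly when a does not jump at n + 1; at a jump it has already occurred,
-- and the next candidate is n + 1 + a(n+1).  That g never repeats a value and that jump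
-- values occur early are Beatty-sequence facts about a, proved by squaring out every
-- comparison with nα and using the irrationality of α.
module Submission where

open import Defs
open import Data.Nat using (ℕ; zero; suc; _+_; _*_; _∸_; _≤_; _<_; _≤?_; z≤n; s≤s)
open import Data.Nat.Properties
open import Data.Nat.Divisibility using (_∣_; divides; ∣m+n∣m⇒∣n; ∣⇒≤; m∣m*n)
open import Data.Nat.Induction using (<-wellFounded)
open import Data.Nat.Tactic.RingSolver using (solve; solve-∀)
open import Data.List using (_∷_; [])
open import Data.Product using (_×_; _,_; proj₁; proj₂; ∃; uncurry)
open import Data.Sum using (_⊎_; inj₁; inj₂)
open import Data.Empty using (⊥; ⊥-elim)
open import Induction.WellFounded using (Acc; acc)
open import Relation.Nullary using (¬_; Dec; yes; no)
open import Relation.Binary.PropositionalEquality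

≤-by-identity : ∀ {A B P Q : ℕ} → P ≤ Q → (R : ℕ) → A + Q + R ≡ B + P → A ≤ B
≤-by-identity {A} {B} {P} {Q} P≤Q R eq = +-cancelʳ-≤ P A B (begin
  A + P      ≤⟨ +-monoʳ-≤ A P≤Q ⟩
  A + Q      ≤⟨ m≤m+n (A + Q) R ⟩
  A + Q + R  ≡⟨ eq ⟩
  B + P      ∎)
  where open ≤-Reasoning

≤-by-sum : ∀ {A B : ℕ} (R : ℕ) → A + R ≡ B → A ≤ B
≤-by-sum {A} R eq = m+n≤o⇒m≤o A (≤-reflexive eq)

-- k ≼ m /φ says k ≤ m/φ and m /φ< k says m/φ < k, squared out using (1/φ)² + 1/φ = 1.
infix 4 _≼_/φ _/φ<_

_≼_/φ : ℕ → ℕ → Set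
k ≼ m /φ = k * k + k * m ≤ m * m

_/φ<_ : ℕ → ℕ → Set
m /φ< k = m * m < k * k + k * m

_≼?_/φ : ∀ k m → Dec (k ≼ m /φ)
k ≼? m /φ = k * k + k * m ≤? m * m

record IsFloor/φ (m k : ℕ) : Set where
  constructor isFloor/φ
  field
    lower : k ≼ m /φ
    upper : m /φ< suc k

open IsFloor/φ

k*k+k*m-mono-≤ : ∀ m {k x} → k ≤ x → k * k + k * m ≤ x * x + x * m
k*k+k*m-mono-≤ m k≤x = +-mono-≤ (*-mono-≤ k≤x k≤x) (*-monoˡ-≤ m k≤x)

≼/φ-/φ<⇒< : ∀ {x m k} → x ≼ m /φ → m /φ< k → x < k
≼/φ-/φ<⇒< {m = m} x≼ m< = ≰⇒> λ k≤x → <⇒≱ m< (≤-trans (k*k+k*m-mono-≤ m k≤x) x≼)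

IsFloor/φ-unique : ∀ {m k x} → IsFloor/φ m k → IsFloor/φ m x → x ≡ k
IsFloor/φ-unique (isFloor/φ k≼ m<k+1) (isFloor/φ x≼ m<x+1) =
  ≤-antisym (≤-pred (≼/φ-/φ<⇒< x≼ m<k+1)) (≤-pred (≼/φ-/φ<⇒< k≼ m<x+1))

m/φ<k⇒m<k+k : ∀ {m k} → m /φ< k → m < k + k
m/φ<k⇒m<k+k {m} {k} m< = ≰⇒> λ 2k≤m → <⇒≱ m< (begin
  k * k + k * m      ≤⟨ +-monoˡ-≤ (k * m) (*-monoʳ-≤ k (≤-trans (m≤m+n k k) 2k≤m)) ⟩
  k * m + k * m      ≡⟨ sym (*-distribʳ-+ m k k) ⟩
  (k + k) * m        ≤⟨ *-monoˡ-≤ m 2k≤m ⟩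
  m * m              ∎)
  where open ≤-Reasoning

≼/φ⇒4*≤3* : ∀ {k m} → k ≼ m /φ → 4 * k ≤ 3 * m
≼/φ⇒4*≤3* {k} {m} k≼ = ≮⇒≥ λ 3m<4k → <⇒≱ (too-big 3m<4k) (*-monoʳ-≤ 16 k≼)
  where
  too-big : 3 * m < 4 * k → 16 * (m * m) < 16 * (k * k + k * m)
  too-big 3m<4k = begin-strict
    16 * (m * m)                                          <⟨ ≤-by-sum (5 * (m * m) + 10 * m) (solve (m ∷ [])) ⟩
    suc (3 * m) * suc (3 * m) + suc (3 * m) * (4 * m)    ≤⟨ k*k+k*m-mono-≤ (4 * m) 3m<4k ⟩
    4 * k * (4 * k) + 4 * k * (4 * m)                     ≡⟨ solve (k ∷ m ∷ []) ⟩
    16 * (k * k + k * m)                                  ∎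
    where open ≤-Reasoning

≼/φ⇒≤ : ∀ {k m} → k ≼ m /φ → k ≤ m
≼/φ⇒≤ {k} {m} k≼ = *-cancelˡ-≤ 4 (≤-trans (≼/φ⇒4*≤3* {k} k≼) (*-monoˡ-≤ m (n≤1+n 3)))

≼1+/φ⇒< : ∀ {k m} → k ≼ suc m /φ → k < suc m
≼1+/φ⇒< {k} {m} k≼ = *-cancelˡ-< 4 k (suc m) (begin-strict
  4 * k        ≤⟨ ≼/φ⇒4*≤3* {k} k≼ ⟩
  3 * suc m    <⟨ *-monoˡ-< (suc m) (n<1+n 3) ⟩
  4 * suc m    ∎)
  where open ≤-Reasoning

golden-descent : ∀ k z → k * k + k * (k + z) ≡ (k + z) * (k + z) → z * z + z * k ≡ k * k
golden-descent k z eq = sym (+-cancelˡ-≡ (k * k + k * z) (k * k) (z * z + z * k) (begin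
  k * k + k * z + k * k          ≡⟨ solve (k ∷ z ∷ []) ⟩
  k * k + k * (k + z)            ≡⟨ eq ⟩
  (k + z) * (k + z)              ≡⟨ solve (k ∷ z ∷ []) ⟩
  k * k + k * z + (z * z + z * k) ∎))
  where open ≡-Reasoning

-- A solution k/m of t² + t = 1 with k < m = k + z yields the smaller solution z/k.
golden-irrational : ∀ {k m} → k * k + k * m ≡ m * m → m ≡ 0
golden-irrational {k} {m} = descent k m (<-wellFounded m)
  where
  descent : ∀ k m → Acc _<_ m → k * k + k * m ≡ m * m → m ≡ 0
  descent k zero    _        _  = refl
  descent k (suc m) (acc rs) eq with suc m ≤? k
  ... | yes m<k = ⊥-elim (<⇒≢ (begin-strict
          suc m * suc m                   <⟨ m<m+n (suc m * suc m) (s≤s z≤n) ⟩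
          suc m * suc m + suc m * suc m   ≤⟨ k*k+k*m-mono-≤ (suc m) m<k ⟩
          k * k + k * suc m               ∎) (sym eq))
    where open ≤-Reasoning
  ... | no m≮k with m≤n⇒∃[o]m+o≡n (<⇒≤ (≰⇒> m≮k))
  ...   | z , k+z≡m with descent z k (rs (≰⇒> m≮k))
                             (golden-descent k z (subst (λ y → k * k + k * y ≡ y * y) (sym k+z≡m) eq))
  ...     | refl = ⊥-elim (0≢1+n eq)

≼1+/φ-strict : ∀ {k m} → k ≼ suc m /φ → k * k + k * suc m < suc m * suc m
≼1+/φ-strict {k} k≼ with m≤n⇒m<n∨m≡n k≼
... | inj₁ lt = lt
... | inj₂ eq = ⊥-elim (0≢1+n (sym (golden-irrational {k} eq)))

≼/φ-suc : ∀ {k m} → k ≼ m /φ → k ≼ suc m /φ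
≼/φ-suc {k} {m} k≼ = ≤-by-identity (+-mono-≤ k≼ (≼/φ⇒≤ {k} k≼)) (suc m) (solve (k ∷ m ∷ []))

≼/φ-mono : ∀ {k m n} → m ≤ n → k ≼ m /φ → k ≼ n /φ
≼/φ-mono {k} {n = zero}  z≤n  k≼ = k≼
≼/φ-mono {k} {n = suc n} m≤1+n k≼ with m≤n⇒m<n∨m≡n m≤1+n
... | inj₁ m<1+n = ≼/φ-suc {k} (≼/φ-mono {k} (≤-pred m<1+n) k≼)
... | inj₂ refl  = k≼

≼/φ-+2 : ∀ {k m} → k ≼ m /φ → suc k ≼ suc (suc m) /φ
≼/φ-+2 {k} {m} k≼ = ≤-by-identity (+-mono-≤ k≼ (≼/φ⇒4*≤3* {k} k≼)) 1 (solve (k ∷ m ∷ []))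

/φ<-suc : ∀ {m k} → m /φ< k → suc m /φ< suc k
/φ<-suc {m} {k} m< = ≤-by-identity (+-mono-≤ m< (m/φ<k⇒m<k+k {m} {k} m<)) (2 + k) (solve (k ∷ m ∷ []))

floor-after-jump : ∀ {j k} → j /φ< suc k → suc k ≼ suc j /φ →
  IsFloor/φ (suc (j + k)) j × IsFloor/φ (suc (suc (j + k))) j
floor-after-jump {j} {k} j< k+1≼ =
  isFloor/φ (≤-by-identity (<⇒≤ j<) 0 (solve (j ∷ k ∷ [])))
            (≤-by-identity k+1≼ (j + 2 * k + 1) (solve (j ∷ k ∷ []))) ,
  isFloor/φ (≤-by-identity (<⇒≤ j<) (j + 2 * k + 3) (solve (j ∷ k ∷ [])))
            (≤-by-identity (≼1+/φ-strict {suc k} k+1≼) 0 (solve (j ∷ k ∷ [])))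

jump-floors : ∀ {k t} → k /φ< suc t → suc t ≼ suc k /φ → IsFloor/φ k t × IsFloor/φ (suc k) (suc t)
jump-floors {k} {t} k< t+1≼ = isFloor/φ t≼k k< , isFloor/φ t+1≼ (/φ<-suc {k} {suc t} k<)
  where
  t≼k : t ≼ k /φ
  t≼k = ≤-by-identity (+-mono-≤ t+1≼ (m/φ<k⇒m<k+k {k} {suc t} k<)) t (solve (k ∷ t ∷ []))

plateau-bounds : ∀ {k t} → k ≼ suc (k + t) /φ → suc (suc (k + t)) /φ< suc k →
                 k /φ< suc t × suc t ≼ suc k /φ
plateau-bounds {k} {t} k≼ n+2< =
  ≤-by-identity (≼1+/φ-strict {k} k≼) 0 (solve (k ∷ t ∷ [])) ,
  ≤-by-identity n+2< 1 (solve (k ∷ t ∷ []))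

double-jump-bounds : ∀ {p q} → suc (q + p) + q /φ< suc (q + p) →
  suc (suc (q + p)) ≼ suc (suc (suc (q + p) + q)) /φ → q /φ< suc p × suc p ≼ suc q /φ
double-jump-bounds {p} {q} m< r+2≼ =
  ≤-by-identity m< 0 (solve (p ∷ q ∷ [])) ,
  ≤-by-identity r+2≼ 0 (solve (p ∷ q ∷ []))

⌊_/φ⌋ : ℕ → ℕ
⌊ zero  /φ⌋ = zero
⌊ suc n /φ⌋ with suc ⌊ n /φ⌋ ≼? suc n /φ
... | yes _ = suc ⌊ n /φ⌋
... | no  _ = ⌊ n /φ⌋

⌊/φ⌋-isFloor : ∀ n → IsFloor/φ n ⌊ n /φ⌋
⌊/φ⌋-isFloor zero = isFloor/φ z≤n (s≤s z≤n)
⌊/φ⌋-isFloor (suc n) with suc ⌊ n /φ⌋ ≼? suc n /φ | ⌊/φ⌋-isFloor n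
... | yes k+1≼ | floor = isFloor/φ k+1≼ (/φ<-suc {n} {suc ⌊ n /φ⌋} (upper floor))
... | no  k+1⋠ | floor = isFloor/φ (≼/φ-suc {⌊ n /φ⌋} (lower floor)) (≰⇒> k+1⋠)

IsFloor/φ⇒≡⌊/φ⌋ : ∀ {m k} → IsFloor/φ m k → ⌊ m /φ⌋ ≡ k
IsFloor/φ⇒≡⌊/φ⌋ {m} floor = IsFloor/φ-unique floor (⌊/φ⌋-isFloor m)

≼/φ⇒≤⌊/φ⌋ : ∀ {k m} → k ≼ m /φ → k ≤ ⌊ m /φ⌋
≼/φ⇒≤⌊/φ⌋ {k} {m} k≼ = ≤-pred (≼/φ-/φ<⇒< {k} k≼ (upper (⌊/φ⌋-isFloor m)))

⌊/φ⌋-mono-≤ : ∀ {m n} → m ≤ n → ⌊ m /φ⌋ ≤ ⌊ n /φ⌋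
⌊/φ⌋-mono-≤ {m} m≤n = ≼/φ⇒≤⌊/φ⌋ (≼/φ-mono {⌊ m /φ⌋} m≤n (lower (⌊/φ⌋-isFloor m)))

⌊1+n/φ⌋≤n : ∀ n → ⌊ suc n /φ⌋ ≤ n
⌊1+n/φ⌋≤n n = ≤-pred (≼1+/φ⇒< {⌊ suc n /φ⌋} (lower (⌊/φ⌋-isFloor (suc n))))

⌊n/φ⌋<⌊2+n/φ⌋ : ∀ n → ⌊ n /φ⌋ < ⌊ suc (suc n) /φ⌋
⌊n/φ⌋<⌊2+n/φ⌋ n = ≼/φ⇒≤⌊/φ⌋ (≼/φ-+2 {⌊ n /φ⌋} (lower (⌊/φ⌋-isFloor n)))

Jump : ℕ → Set
Jump n = ⌊ suc n /φ⌋ ≡ suc ⌊ n /φ⌋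

Flat : ℕ → Set
Flat n = ⌊ suc n /φ⌋ ≡ ⌊ n /φ⌋

jump-or-flat : ∀ n → Jump n ⊎ Flat n
jump-or-flat n with suc ⌊ n /φ⌋ ≼? suc n /φ
... | yes _ = inj₁ refl
... | no  _ = inj₂ refl

¬jump×flat : ∀ {n} → Jump n → Flat n → ⊥
¬jump×flat jump flat = 1+n≢n (trans (sym jump) flat)

IsFloor/φ⇒Jump : ∀ {k t} → IsFloor/φ k t → IsFloor/φ (suc k) (suc t) → Jump k
IsFloor/φ⇒Jump floor floor′ =
  trans (IsFloor/φ⇒≡⌊/φ⌋ floor′) (cong suc (sym (IsFloor/φ⇒≡⌊/φ⌋ floor)))

jump⇒flat : ∀ j → Jump j → Flat (suc (j + ⌊ j /φ⌋))
jump⇒flat j jump =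
  let floor , floor′ = floor-after-jump {j} {⌊ j /φ⌋} (upper (⌊/φ⌋-isFloor j))
                         (subst (_≼ suc j /φ) jump (lower (⌊/φ⌋-isFloor (suc j))))
  in trans (IsFloor/φ⇒≡⌊/φ⌋ floor′) (sym (IsFloor/φ⇒≡⌊/φ⌋ floor))

flat⇒jump : ∀ n → Flat (suc n) → Jump ⌊ suc n /φ⌋
flat⇒jump n flat = plateau⇒jump (⌊1+n/φ⌋≤n n) (lower (⌊/φ⌋-isFloor (suc n)))
                     (subst (λ k → suc (suc n) /φ< suc k) flat (upper (⌊/φ⌋-isFloor (suc (suc n)))))
  where
  plateau⇒jump : ∀ {k n} → k ≤ n → k ≼ suc n /φ → suc (suc n) /φ< suc k → Jump k
  plateau⇒jump {k} k≤n k≼ n+2< with m≤n⇒∃[o]m+o≡n k≤n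
  ... | t , refl = uncurry IsFloor/φ⇒Jump (uncurry (jump-floors {k} {t}) (plateau-bounds {k} {t} k≼ n+2<))

double-jump⇒earlier-jump : ∀ m → Jump m → Jump (suc m) →
  ∃ λ q → q ≤ m × Jump q × suc q + ⌊ suc q /φ⌋ ≡ suc (suc ⌊ m /φ⌋)
double-jump⇒earlier-jump m jump jump′ =
  from-bounds (subst (_≤ m) jump (⌊1+n/φ⌋≤n m)) (upper (⌊/φ⌋-isFloor m))
    (subst (_≼ suc (suc m) /φ) (trans jump′ (cong suc jump)) (lower (⌊/φ⌋-isFloor (suc (suc m)))))
  where
  from-bounds : ∀ {r m} → suc r ≤ m → m /φ< suc r → suc (suc r) ≼ suc (suc m) /φ →
                ∃ λ q → q ≤ m × Jump q × suc q + ⌊ suc q /φ⌋ ≡ suc (suc r)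
  from-bounds {r} r<m m< r+2≼ with m≤n⇒∃[o]m+o≡n r<m
  ... | q , refl
    with m≤n⇒∃[o]m+o≡n (≤-pred (+-cancelˡ-< (suc r) q (suc r) (m/φ<k⇒m<k+k {suc r + q} {suc r} m<)))
  ... | p , refl with uncurry jump-floors (double-jump-bounds {p} {q} m< r+2≼)
  ... | floor , floor′ = q , m≤n+m q (suc (q + p)) , IsFloor/φ⇒Jump floor floor′ ,
                         trans (cong (suc q +_) (IsFloor/φ⇒≡⌊/φ⌋ floor′)) (cong suc (+-suc q p))

-- At a jump of ⌊_/φ⌋ this is ⌊(n+1)φ⌋ = n + 1 + ⌊(n+1)/φ⌋, otherwise ⌊(n+1)/φ⌋ + 1.
goldenSeq : ℕ → ℕ
goldenSeq zero    = zero
goldenSeq (suc n) with suc ⌊ n /φ⌋ ≼? suc n /φ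
... | yes _ = suc n + suc ⌊ n /φ⌋
... | no  _ = suc ⌊ n /φ⌋

goldenSeq-cases : ∀ n → (Jump n × goldenSeq (suc n) ≡ suc n + ⌊ suc n /φ⌋)
                      ⊎ (Flat n × goldenSeq (suc n) ≡ suc ⌊ suc n /φ⌋)
goldenSeq-cases n with suc ⌊ n /φ⌋ ≼? suc n /φ
... | yes _ = inj₁ (refl , refl)
... | no  _ = inj₂ (refl , refl)

goldenSeq-jump : ∀ {n} → Jump n → goldenSeq (suc n) ≡ suc n + ⌊ suc n /φ⌋
goldenSeq-jump {n} jump with goldenSeq-cases n
... | inj₁ (_ , eq)    = eq
... | inj₂ (flat , _) = ⊥-elim (¬jump×flat {n} jump flat)

goldenSeq-flat : ∀ {n} → Flat n → goldenSeq (suc n) ≡ suc ⌊ suc n /φ⌋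
goldenSeq-flat {n} flat with goldenSeq-cases n
... | inj₁ (jump , _) = ⊥-elim (¬jump×flat {n} jump flat)
... | inj₂ (_ , eq)    = eq

sum-goldenSeq : ∀ n → sumFrom1 goldenSeq n ≡ n * suc ⌊ n /φ⌋
sum-goldenSeq zero = refl
sum-goldenSeq (suc n) with suc ⌊ n /φ⌋ ≼? suc n /φ
... | yes _ = trans (cong (_+ (suc n + suc ⌊ n /φ⌋)) (sum-goldenSeq n)) (jump-step n (suc ⌊ n /φ⌋))
  where
  jump-step : ∀ n k → n * k + (suc n + k) ≡ suc n * suc k
  jump-step = solve-∀
... | no  _ = trans (cong (_+ suc ⌊ n /φ⌋) (sum-goldenSeq n)) (+-comm (n * suc ⌊ n /φ⌋) (suc ⌊ n /φ⌋))

0<goldenSeq : ∀ n → 0 < goldenSeq (suc n)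
0<goldenSeq n with suc ⌊ n /φ⌋ ≼? suc n /φ
... | yes _ = s≤s z≤n
... | no  _ = s≤s z≤n

jump-value≢flat-value : ∀ {i n} → Jump i → Flat (suc n) →
                        suc i + ⌊ suc i /φ⌋ ≢ suc ⌊ suc (suc n) /φ⌋
jump-value≢flat-value {i} {n} jump flat eq =
  ¬jump×flat {⌊ suc n /φ⌋} (flat⇒jump n flat) (subst Flat i+⌊i/φ⌋+1≡⌊n+1/φ⌋ (jump⇒flat i jump))
  where
  open ≡-Reasoning
  i+⌊i/φ⌋+1≡⌊n+1/φ⌋ : suc (i + ⌊ i /φ⌋) ≡ ⌊ suc n /φ⌋
  i+⌊i/φ⌋+1≡⌊n+1/φ⌋ = begin
    suc (i + ⌊ i /φ⌋)   ≡⟨ sym (+-suc i ⌊ i /φ⌋) ⟩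
    i + suc ⌊ i /φ⌋     ≡⟨ cong (i +_) (sym jump) ⟩
    i + ⌊ suc i /φ⌋     ≡⟨ suc-injective eq ⟩
    ⌊ suc (suc n) /φ⌋   ≡⟨ flat ⟩
    ⌊ suc n /φ⌋         ∎

goldenSeq-fresh : ∀ {i n} → i ≤ n → goldenSeq i ≢ goldenSeq (suc n)
goldenSeq-fresh {zero}  {n}     _   = <⇒≢ (0<goldenSeq n)
goldenSeq-fresh {suc i} {zero}  ()
goldenSeq-fresh {suc i} {suc n} i≤n with goldenSeq-cases i | goldenSeq-cases (suc n)
... | inj₁ (_ , gi)    | inj₁ (_ , gn)    =
  <⇒≢ (subst₂ _<_ (sym gi) (sym gn) (+-mono-<-≤ (s≤s i≤n) (⌊/φ⌋-mono-≤ (m≤n⇒m≤1+n i≤n))))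
... | inj₂ (_ , gi)    | inj₁ (_ , gn)    =
  <⇒≢ (subst₂ _<_ (sym gi) (sym gn)
         (s≤s (+-mono-<-≤ (s≤s z≤n) (⌊/φ⌋-mono-≤ (m≤n⇒m≤1+n i≤n)))))
... | inj₂ (flat , gi) | inj₂ (_ , gn)    =
  <⇒≢ (subst₂ _<_ (sym gi) (sym gn) (s≤s (begin-strict
    ⌊ suc i /φ⌋          ≡⟨ flat ⟩
    ⌊ i /φ⌋              <⟨ ⌊n/φ⌋<⌊2+n/φ⌋ i ⟩
    ⌊ suc (suc i) /φ⌋    ≤⟨ ⌊/φ⌋-mono-≤ (s≤s i≤n) ⟩
    ⌊ suc (suc n) /φ⌋    ∎)))
  where open ≤-Reasoning
... | inj₁ (jump , gi) | inj₂ (flat , gn) =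
  λ eq → jump-value≢flat-value {i} {n} jump flat (trans (sym gi) (trans eq gn))

jump⇒seen : ∀ n → Jump n → Among goldenSeq (suc n) (suc ⌊ n /φ⌋)
jump⇒seen zero ()
jump⇒seen (suc m) jump with jump-or-flat m
... | inj₂ flat  = suc m , ≤-refl , goldenSeq-flat {m} flat
... | inj₁ jump′ =
  let q , q≤m , jump-q , eq = double-jump⇒earlier-jump m jump′ jump
  in suc q , s≤s (s≤s q≤m) , trans (goldenSeq-jump {q} jump-q) (trans eq (cong suc (sym jump′)))

-- n·c + m ≡ m − c (mod n + 1).
1+n∣n*c+m⇒m≡c⊎c+1+n≤m : ∀ {n c m} → c ≤ n → suc n ∣ n * c + m → m ≡ c ⊎ c + suc n ≤ m
1+n∣n*c+m⇒m≡c⊎c+1+n≤m {n} {c} {m} c≤n div with c ≤? m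
... | yes c≤m with m≤n⇒∃[o]m+o≡n c≤m
...   | zero  , refl = inj₁ (+-identityʳ c)
...   | suc d , refl =
  inj₂ (+-monoʳ-≤ c (∣⇒≤ (∣m+n∣m⇒∣n (subst (suc n ∣_) shift div) (m∣m*n c))))
  where
  shift : n * c + (c + suc d) ≡ suc n * c + suc d
  shift = solve (n ∷ c ∷ d ∷ [])
1+n∣n*c+m⇒m≡c⊎c+1+n≤m {n} {c} {m} c≤n div | no c≰m with m≤n⇒∃[o]m+o≡n (≰⇒> c≰m)
... | d , refl =
  ⊥-elim (1+n≰n (≤-trans (∣⇒≤ (∣m+n∣m⇒∣n (subst (suc n ∣_) (sym shift) (m∣m*n (suc m + d))) div))
                         (≤-trans (s≤s (m≤n+m d m)) c≤n)))
  where
  shift : n * (suc m + d) + m + suc d ≡ suc n * (suc m + d)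
  shift = solve (n ∷ m ∷ d ∷ [])

sumFrom1-cong : ∀ {f g : ℕ → ℕ} n → (∀ {j} → j ≤ n → f j ≡ g j) → sumFrom1 f n ≡ sumFrom1 g n
sumFrom1-cong zero    _   = refl
sumFrom1-cong (suc n) f≗g =
  cong₂ _+_ (sumFrom1-cong n (λ j≤n → f≗g (m≤n⇒m≤1+n j≤n))) (f≗g ≤-refl)

Among-cong : ∀ {f g : ℕ → ℕ} {n v} → (∀ {j} → j < n → f j ≡ g j) → Among f n v → Among g n v
Among-cong f≗g (i , i<n , fi≡v) = i , i<n , trans (sym (f≗g i<n)) fi≡v


goldenSeq-admissible : ∀ {h} n → (∀ {j} → j ≤ n → h j ≡ goldenSeq j) →
                       Admissible h (suc n) (goldenSeq (suc n))
goldenSeq-admissible {h} n h≗ = unseen , divides (suc ⌊ suc n /φ⌋) (begin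
  sumFrom1 h n + goldenSeq (suc n)   ≡⟨ cong (_+ goldenSeq (suc n)) (sumFrom1-cong n h≗) ⟩
  sumFrom1 goldenSeq (suc n)         ≡⟨ sum-goldenSeq (suc n) ⟩
  suc n * suc ⌊ suc n /φ⌋            ≡⟨ *-comm (suc n) (suc ⌊ suc n /φ⌋) ⟩
  suc ⌊ suc n /φ⌋ * suc n            ∎)
  where
  open ≡-Reasoning
  unseen : ¬ Among h (suc n) (goldenSeq (suc n))
  unseen seen =
    let i , i<1+n , eq = Among-cong (λ i<1+n → h≗ (≤-pred i<1+n)) seen
    in goldenSeq-fresh (≤-pred i<1+n) eq

-- Divisibility by n + 2 leaves only c = ⌊(n+1)/φ⌋ + 1 or values ≥ c + n + 2, and at a jump c is taken.
admissible⇒goldenSeq≤ : ∀ {h} n → (∀ {j} → j ≤ n → h j ≡ goldenSeq j) →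
                        ∀ {v} → Admissible h (suc n) v → goldenSeq (suc n) ≤ v
admissible⇒goldenSeq≤ zero h≗ {zero}  (unseen , _) = ⊥-elim (unseen (0 , s≤s z≤n , h≗ z≤n))
admissible⇒goldenSeq≤ zero h≗ {suc v} _            = s≤s z≤n
admissible⇒goldenSeq≤ {h} (suc n) h≗ {v} (unseen , div) =
  settle (goldenSeq-cases (suc n)) (1+n∣n*c+m⇒m≡c⊎c+1+n≤m (s≤s (⌊1+n/φ⌋≤n n)) div′)
  where
  c = suc ⌊ suc n /φ⌋
  div′ : suc (suc n) ∣ suc n * c + v
  div′ = subst (λ s → suc (suc n) ∣ s + v) (trans (sumFrom1-cong (suc n) h≗) (sum-goldenSeq (suc n))) div
  settle : (Jump (suc n) × goldenSeq (suc (suc n)) ≡ suc (suc n) + ⌊ suc (suc n) /φ⌋)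
         ⊎ (Flat (suc n) × goldenSeq (suc (suc n)) ≡ suc ⌊ suc (suc n) /φ⌋) →
           v ≡ c ⊎ c + suc (suc n) ≤ v → goldenSeq (suc (suc n)) ≤ v
  settle (inj₁ (jump , g≡)) (inj₁ v≡c) =
    ⊥-elim (unseen (subst (Among h (suc (suc n))) (sym v≡c)
                     (Among-cong (λ i<n+2 → sym (h≗ (≤-pred i<n+2))) (jump⇒seen (suc n) jump))))
  settle (inj₁ (jump , g≡)) (inj₂ c+n+2≤v) =
    ≤-trans (≤-reflexive (trans g≡ (trans (cong (suc (suc n) +_) jump) (+-comm (suc (suc n)) c)))) c+n+2≤v
  settle (inj₂ (flat , g≡)) (inj₁ v≡c) = ≤-reflexive (trans g≡ (trans (cong suc flat) (sym v≡c)))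
  settle (inj₂ (flat , g≡)) (inj₂ c+n+2≤v) =
    ≤-trans (≤-reflexive (trans g≡ (cong suc flat))) (≤-trans (m≤m+n c (suc (suc n))) c+n+2≤v)

IsSeq⇒≡goldenSeq : ∀ {f} → IsSeq f → ∀ n {j} → j ≤ n → f j ≡ goldenSeq j
IsSeq⇒≡goldenSeq (f0≡0 , _) zero z≤n = f0≡0
IsSeq⇒≡goldenSeq {f} isSeq@(_ , least) (suc n) j≤1+n with m≤n⇒m<n∨m≡n j≤1+n
... | inj₁ j<1+n = IsSeq⇒≡goldenSeq isSeq n (≤-pred j<1+n)
... | inj₂ refl  = ≤-antisym f≤g (admissible⇒goldenSeq≤ n prefix (proj₁ (least (suc n) (s≤s z≤n))))
  where
  prefix : ∀ {j} → j ≤ n → f j ≡ goldenSeq j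
  prefix = IsSeq⇒≡goldenSeq isSeq n
  f≤g : f (suc n) ≤ goldenSeq (suc n)
  f≤g = ≮⇒≥ λ g<f →
    proj₂ (least (suc n) (s≤s z≤n)) (goldenSeq (suc n)) g<f (goldenSeq-admissible n prefix)

goldenSeq-bounds : ∀ n →
  suc ⌊ suc n /φ⌋ ≤ goldenSeq (suc n) × goldenSeq (suc n) ≤ suc n + ⌊ suc n /φ⌋
goldenSeq-bounds n with goldenSeq-cases n
... | inj₁ (_ , g≡) rewrite g≡ = s≤s (m≤n+m ⌊ suc n /φ⌋ n) , ≤-refl
... | inj₂ (_ , g≡) rewrite g≡ = ≤-refl , s≤s (m≤n+m ⌊ suc n /φ⌋ n)

≤n/φ⇒≼/φ : ∀ {x n} → x ≤n/φ n → x ≼ n /φ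
≤n/φ⇒≼/φ {x} {n} le =
  *-cancelˡ-≤ 4 (≤-by-identity {P = (2 * x + n) * (2 * x + n)} {Q = 5 * (n * n)} le 0 (solve (x ∷ n ∷ [])))

n/φ<⇒/φ< : ∀ {n x} → n n/φ< x → n /φ< x
n/φ<⇒/φ< {n} {x} 5n²< = ≰⇒> λ x≼ → <⇒≱ 5n²< (begin
  (2 * x + n) * (2 * x + n)   ≡⟨ solve (x ∷ n ∷ []) ⟩
  4 * (x * x + x * n) + n * n ≤⟨ +-monoˡ-≤ (n * n) (*-monoʳ-≤ 4 x≼) ⟩
  4 * (n * n) + n * n         ≡⟨ solve (n ∷ []) ⟩
  5 * (n * n)                 ∎)
  where open ≤-Reasoning

IsFloorDivφ⇒IsFloor/φ : ∀ {n a} → IsFloorDivφ n a → IsFloor/φ n a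
IsFloorDivφ⇒IsFloor/φ {n} {a} (a≤ , n<) = isFloor/φ (≤n/φ⇒≼/φ {a} a≤) (n/φ<⇒/φ< {n} {suc a} n<)

-- a ≤ n/φ = nφ − n gives n + a ≤ nφ < b + 1.
≤n/φ∧nφ<1+⇒+≤ : ∀ {n a b} → a ≤n/φ n → n nφ< suc b → n + a ≤ b
≤n/φ∧nφ<1+⇒+≤ {n} {a} {b} a≤ n< = ≮⇒≥ λ b<n+a → <⇒≱ n< (begin
  sq (2 * suc b ∸ n)   ≤⟨ *-mono-≤ (2b+2-n≤2a+n b<n+a) (2b+2-n≤2a+n b<n+a) ⟩
  sq (2 * a + n)       ≤⟨ a≤ ⟩
  5 * sq n             ∎)
  where
  open ≤-Reasoning
  2b+2-n≤2a+n : b < n + a → 2 * suc b ∸ n ≤ 2 * a + n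
  2b+2-n≤2a+n b<n+a = begin
    2 * suc b ∸ n         ≤⟨ ∸-monoˡ-≤ n (*-monoʳ-≤ 2 b<n+a) ⟩
    2 * (n + a) ∸ n       ≡⟨ cong (_∸ n) (solve (n ∷ a ∷ [])) ⟩
    (2 * a + n) + n ∸ n   ≡⟨ m+n∸n≡m (2 * a + n) n ⟩
    2 * a + n             ∎

corollary5 : (f : ℕ → ℕ) → IsSeq f →
    (n : ℕ) → 1 ≤ n → (a b : ℕ) → IsFloorDivφ n a → IsFloorMulφ n b →
    (suc a ≤ f n) × (f n ≤ b)
corollary5 f isSeq (suc n) _ a b floorDiv floorMul
  rewrite IsSeq⇒≡goldenSeq isSeq (suc n) ≤-refl
  with IsFloor/φ⇒≡⌊/φ⌋ (IsFloorDivφ⇒IsFloor/φ {suc n} {a} floorDiv) | goldenSeq-bounds n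
... | refl | a<g , g≤n+a =
  a<g , ≤-trans g≤n+a (≤n/φ∧nφ<1+⇒+≤ {suc n} (proj₁ floorDiv) (proj₂ floorMul))
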